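{- For every integer $k \geq 1$ and every $n \geq 2k+3$, $\mathrm{Aut}(\mathrm{Circ}(n,\{1,2,\ldots,k\})) \cong \mathrm{Dih}(n)$.
   Context: $\mathrm{Circ}(n, S)$, for $S \subseteq \mathbb{Z}_n$, is the circulant graph with vertex set $\mathbb{Z}_n$ in which $u,v$ are adjacent iff $u - v \equiv \pm s \pmod n$ for some $s \in S$. $\mathrm{Dih}(n)$ is the dihedral group of order $2n$. $\mathrm{Aut}$ denotes the full automorphism group. -}

module Defs where

open import Level using (0ℓ)
open import Data.Nat as ℕ using (ℕ; _≤_)
open import Data.Integer as ℤ using (ℤ; +_; -_; _-_)
open import Data.Integer.Divisibility using (_∣_)
open import Data.Fin using (Fin; toℕ)
open import Data.Bool using (Bool; true; false; if_then_else_; _xor_)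
open import Data.Product using (Σ; ∃-syntax; _×_; _,_; proj₁; proj₂)
open import Data.Sum using (_⊎_)
open import Function using (_∘_; id)
open import Relation.Binary.PropositionalEquality using (_≡_; refl; cong; trans; sym; subst₂)
open import Algebra.Bundles.Raw using (RawGroup)
open import Algebra.Morphism.Structures using (module GroupMorphisms)

⟦_⟧ : {n : ℕ} → Fin n → ℤ
⟦ u ⟧ = + toℕ u

CircAdj : (n k : ℕ) → Fin n → Fin n → Set
CircAdj n k u v =
  ∃[ s ] (1 ≤ s × s ≤ k ×
          ((+ n ∣ ((⟦ u ⟧ - ⟦ v ⟧) - + s)) ⊎ (+ n ∣ ((⟦ u ⟧ - ⟦ v ⟧) - (- + s)))))

record CircAut (n k : ℕ) : Set where
  field
    fun      : Fin n → Fin n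
    inv      : Fin n → Fin n
    inv-fun  : ∀ x → inv (fun x) ≡ x
    fun-inv  : ∀ x → fun (inv x) ≡ x
    adj→     : ∀ u v → CircAdj n k u v → CircAdj n k (fun u) (fun v)
    adj←     : ∀ u v → CircAdj n k (fun u) (fun v) → CircAdj n k u v
open CircAut public

_≈Aut_ : ∀ {n k} → CircAut n k → CircAut n k → Set
f ≈Aut g = ∀ x → fun f x ≡ fun g x

_∘Aut_ : ∀ {n k} → CircAut n k → CircAut n k → CircAut n k
f ∘Aut g = record
  { fun = fun f ∘ fun g
  ; inv = inv g ∘ inv f
  ; inv-fun = λ x → trans (cong (inv g) (inv-fun f (fun g x))) (inv-fun g x)
  ; fun-inv = λ x → trans (cong (fun f) (fun-inv g (inv f x))) (fun-inv f x)
  ; adj→ = λ u v a → adj→ f _ _ (adj→ g u v a)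
  ; adj← = λ u v a → adj← g u v (adj← f _ _ a)
  }

idAut : ∀ {n k} → CircAut n k
idAut = record
  { fun = id ; inv = id ; inv-fun = λ _ → refl ; fun-inv = λ _ → refl
  ; adj→ = λ _ _ a → a ; adj← = λ _ _ a → a }

invAut : ∀ {n k} → CircAut n k → CircAut n k
invAut {n} {k} f = record
  { fun = inv f ; inv = fun f ; inv-fun = fun-inv f ; fun-inv = inv-fun f
  ; adj→ = λ u v a → adj← f (inv f u) (inv f v)
             (subst₂ (CircAdj n k) (sym (fun-inv f u)) (sym (fun-inv f v)) a)
  ; adj← = λ u v a → subst₂ (CircAdj n k) (fun-inv f u) (fun-inv f v)
             (adj→ f (inv f u) (inv f v) a) }

AutGroup : (n k : ℕ) → RawGroup 0ℓ 0ℓ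
AutGroup n k = record
  { Carrier = CircAut n k ; _≈_ = _≈Aut_ ; _∙_ = _∘Aut_ ; ε = idAut ; _⁻¹ = invAut }

-- The dihedral group Dih(n) of order 2n, as ℤ_n ⋊ ℤ_2:
-- (false , a) is the rotation x ↦ x + a, (true , a) the reflection x ↦ a - x;
-- the ℤ_n-component is an integer taken modulo n.
_≈Dih_ : {n : ℕ} → Bool × ℤ → Bool × ℤ → Set
_≈Dih_ {n} (b , a) (b' , a') = (b ≡ b') × (+ n ∣ (a - a'))

_∙Dih_ : Bool × ℤ → Bool × ℤ → Bool × ℤ
(b , a) ∙Dih (b' , a') = (b xor b' , a ℤ.+ (if b then - a' else a'))

invDih : Bool × ℤ → Bool × ℤ
invDih (b , a) = (b , (if b then a else - a))

DihGroup : (n : ℕ) → RawGroup 0ℓ 0ℓ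
DihGroup n = record
  { Carrier = Bool × ℤ ; _≈_ = _≈Dih_ {n} ; _∙_ = _∙Dih_
  ; ε = (false , + 0) ; _⁻¹ = invDih }

_≅_ : RawGroup 0ℓ 0ℓ → RawGroup 0ℓ 0ℓ → Set
G ≅ H = Σ (RawGroup.Carrier G → RawGroup.Carrier H) (GroupMorphisms.IsGroupIsomorphism G H)

{-# OPTIONS --safe #-}

-- The closed neighbourhood of a vertex u of Circ(n, {1, …, k}) is N[u] = u + [-k, k]. Call u
-- and v near when at most one vertex of N[u] lies outside N[v]; this is phrased through
-- adjacency alone, so automorphisms preserve it. For u ≠ v it holds exactly when v = u ± 1,
-- as long as n ≥ 2k + 3: if v = u + d with 2 ≤ d ≤ n - 2, then the two consecutive vertices
-- u + d - k - 2, u + d - k - 1 (when d ≤ 2k + 1), or u + k - 1, u + k (when d ≥ 2k + 2), lie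
-- in N[u] but not in N[v]. Hence every automorphism preserves the Hamiltonian cycle
-- 0, 1, …, n - 1, and an automorphism of that cycle is determined by the images of 0 and 1:
-- it is x ↦ a + x or x ↦ a - x. All these maps are automorphisms of the circulant, and
-- recording which of them an automorphism is gives the isomorphism with Dih(n).

module Submission where

open import Defs
open import Data.Nat using (ℕ; _≤_; _+_; _*_)
open import Data.Nat as ℕ using (suc; zero; _∸_; _<_; z≤n; s≤s; NonZero)
import Data.Nat.Properties as ℕₚ
import Data.Nat.Divisibility as ℕ∣
open import Data.Integer as ℤ using (ℤ; +_; -_; 0ℤ; 1ℤ)
  renaming (_+_ to _+ᶻ_; _-_ to _-ᶻ_; _*_ to _*ᶻ_)
import Data.Integer.Properties as ℤₚ
import Data.Integer.Divisibility as ℤ∣ᵤ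
open import Data.Integer.Divisibility.Signed using (_∣_; divides; ∣ᵤ⇒∣; ∣⇒∣ᵤ; ∣m∣n⇒∣m+n; ∣m⇒∣-m)
open import Data.Integer.DivMod using (_%ℕ_; _/ℕ_; a≡a%ℕn+[a/ℕn]*n; n%ℕd<d)
open import Data.Integer.Tactic.RingSolver using (solve-∀)
import Data.Nat.Tactic.RingSolver as ℕ-Solver
open import Algebra.Morphism.Structures using (module GroupMorphisms)
open import Data.Fin using (Fin; toℕ; fromℕ<)
import Data.Fin.Properties as Finₚ
open import Data.Sum as Sum using (_⊎_; inj₁; inj₂)
open import Data.Bool using (Bool; true; false; if_then_else_; _xor_)
open import Data.Product using (Σ; ∃-syntax; _×_; _,_; proj₁; proj₂)
open import Relation.Binary.Bundles using (Setoid)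
open import Relation.Binary.Structures using (IsEquivalence)
open import Relation.Binary.PropositionalEquality
open import Data.Empty using (⊥; ⊥-elim)
open import Function using (_∘_)
open import Relation.Nullary using (¬_; contradiction; yes; no)

∣∧<⇒≡0 : ∀ {m n} → n ℕ∣.∣ m → m < n → m ≡ 0
∣∧<⇒≡0 {zero}  _   _   = refl
∣∧<⇒≡0 {suc m} n∣m m<n = contradiction n∣m (ℕ∣.>⇒∤ m<n)

≤-via : ∀ {m o} c → m + c ≡ o → m ≤ o
≤-via {m} c m+c≡o = ℕₚ.m+n≤o⇒m≤o m (ℕₚ.≤-reflexive m+c≡o)

2k+3≤n⇒2<n : ∀ k {n} → 2 * k + 3 ≤ n → 2 < n
2k+3≤n⇒2<n k 2k+3≤n = ℕₚ.≤-trans (ℕₚ.m≤n+m 3 (2 * k)) 2k+3≤n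

-- Written with if_then_else_ so that _∙Dih_ from Defs unfolds into it.
reflectIf : Bool → ℤ → ℤ
reflectIf b z = if b then - z else z

act : Bool × ℤ → ℤ → ℤ
act (b , a) z = a +ᶻ reflectIf b z

reflectIf-xor : ∀ b b' z → reflectIf b (reflectIf b' z) ≡ reflectIf (b xor b') z
reflectIf-xor false b'    z = refl
reflectIf-xor true  false z = refl
reflectIf-xor true  true  z = ℤₚ.neg-involutive z

reflectIf-+ : ∀ b x y → reflectIf b (x +ᶻ y) ≡ reflectIf b x +ᶻ reflectIf b y
reflectIf-+ false x y = refl
reflectIf-+ true  x y = ℤₚ.neg-distrib-+ x y

reflectIf-neg : ∀ b x → reflectIf b (- x) ≡ - reflectIf b x
reflectIf-neg false x = refl
reflectIf-neg true  x = refl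

act-∙ : ∀ p q z → act (p ∙Dih q) z ≡ act p (act q z)
act-∙ (b , a) (b' , a') z = begin
  (a +ᶻ reflectIf b a') +ᶻ reflectIf (b xor b') z          ≡⟨ cong ((a +ᶻ reflectIf b a') +ᶻ_) (reflectIf-xor b b' z) ⟨
  (a +ᶻ reflectIf b a') +ᶻ reflectIf b (reflectIf b' z)   ≡⟨ ℤₚ.+-assoc a _ _ ⟩
  a +ᶻ (reflectIf b a' +ᶻ reflectIf b (reflectIf b' z))   ≡⟨ cong (a +ᶻ_) (reflectIf-+ b a' (reflectIf b' z)) ⟨
  a +ᶻ reflectIf b (a' +ᶻ reflectIf b' z)                  ∎
  where open ≡-Reasoning

act-identity : ∀ z → act (false , 0ℤ) z ≡ z
act-identity = ℤₚ.+-identityˡ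

∙Dih-inverseˡ : ∀ p → invDih p ∙Dih p ≡ (false , 0ℤ)
∙Dih-inverseˡ (false , a) = cong (false ,_) (ℤₚ.+-inverseˡ a)
∙Dih-inverseˡ (true  , a) = cong (false ,_) (ℤₚ.+-inverseʳ a)

∙Dih-inverseʳ : ∀ p → p ∙Dih invDih p ≡ (false , 0ℤ)
∙Dih-inverseʳ (false , a) = cong (false ,_) (ℤₚ.+-inverseʳ a)
∙Dih-inverseʳ (true  , a) = cong (false ,_) (ℤₚ.+-inverseʳ a)

act-cancel : ∀ p q z → p ∙Dih q ≡ (false , 0ℤ) → act p (act q z) ≡ z
act-cancel p q z pq≡ε = begin
  act p (act q z)       ≡⟨ act-∙ p q z ⟨
  act (p ∙Dih q) z      ≡⟨ cong (λ r → act r z) pq≡ε ⟩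
  act (false , 0ℤ) z    ≡⟨ act-identity z ⟩
  z                     ∎
  where open ≡-Reasoning

act-difference : ∀ p x y → act p x -ᶻ act p y ≡ reflectIf (proj₁ p) (x -ᶻ y)
act-difference (b , a) x y = begin
  (a +ᶻ reflectIf b x) -ᶻ (a +ᶻ reflectIf b y)   ≡⟨ cancel-offset a (reflectIf b x) (reflectIf b y) ⟩
  reflectIf b x -ᶻ reflectIf b y                    ≡⟨ cong (reflectIf b x +ᶻ_) (reflectIf-neg b y) ⟨
  reflectIf b x +ᶻ reflectIf b (- y)                ≡⟨ reflectIf-+ b x (- y) ⟨
  reflectIf b (x -ᶻ y)                              ∎
  where
  open ≡-Reasoning
  cancel-offset : ∀ a u w → (a +ᶻ u) -ᶻ (a +ᶻ w) ≡ u -ᶻ w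
  cancel-offset = solve-∀

act-zero : ∀ p → act p 0ℤ ≡ proj₂ p
act-zero (false , a) = ℤₚ.+-identityʳ a
act-zero (true  , a) = ℤₚ.+-identityʳ a

act-+ : ∀ p z w → act p z +ᶻ reflectIf (proj₁ p) w ≡ act p (w +ᶻ z)
act-+ (b , a) z w = begin
  (a +ᶻ reflectIf b z) +ᶻ reflectIf b w   ≡⟨ ℤₚ.+-assoc a _ _ ⟩
  a +ᶻ (reflectIf b z +ᶻ reflectIf b w)   ≡⟨ cong (a +ᶻ_) (ℤₚ.+-comm (reflectIf b z) _) ⟩
  a +ᶻ (reflectIf b w +ᶻ reflectIf b z)   ≡⟨ cong (a +ᶻ_) (reflectIf-+ b w z) ⟨
  a +ᶻ reflectIf b (w +ᶻ z)               ∎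
  where open ≡-Reasoning

reflectIf-1-dichotomy : ∀ b b' → reflectIf b' 1ℤ ≡ reflectIf b 1ℤ ⊎ reflectIf b' 1ℤ ≡ reflectIf b (- 1ℤ)
reflectIf-1-dichotomy false false = inj₁ refl
reflectIf-1-dichotomy false true  = inj₂ refl
reflectIf-1-dichotomy true  false = inj₂ refl
reflectIf-1-dichotomy true  true  = inj₁ refl

neg-difference : ∀ a b → - (a -ᶻ b) ≡ b -ᶻ a
neg-difference = solve-∀

module Congruence (n : ℕ) .{{_ : NonZero n}} where

  infix 4 _≋_
  -- A record rather than a synonym for + n ∣ a -ᶻ b, so that a and b can be inferred.
  record _≋_ (a b : ℤ) : Set where
    constructor mk≋
    field modulus∣difference : + n ∣ a -ᶻ b
  open _≋_

  ≡⇒≋ : ∀ {a b} → a ≡ b → a ≋ b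
  ≡⇒≋ {a} refl = mk≋ (divides 0ℤ (ℤₚ.+-inverseʳ a))

  ≋-sym : ∀ {a b} → a ≋ b → b ≋ a
  ≋-sym {a} {b} (mk≋ p) = mk≋ (subst (+ n ∣_) (neg-difference a b) (∣m⇒∣-m p))

  ≋-trans : ∀ {a b c} → a ≋ b → b ≋ c → a ≋ c
  ≋-trans {a} {b} {c} (mk≋ p) (mk≋ q) = mk≋ (subst (+ n ∣_) (telescope a b c) (∣m∣n⇒∣m+n p q))
    where
    telescope : ∀ a b c → (a -ᶻ b) +ᶻ (b -ᶻ c) ≡ a -ᶻ c
    telescope = solve-∀

  ≋-isEquivalence : IsEquivalence _≋_
  ≋-isEquivalence = record { refl = ≡⇒≋ refl ; sym = ≋-sym ; trans = ≋-trans }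

  ≋-setoid : Setoid _ _
  ≋-setoid = record { isEquivalence = ≋-isEquivalence }

  open import Relation.Binary.Reasoning.Setoid ≋-setoid

  +-cong-≋ : ∀ {a b c d} → a ≋ b → c ≋ d → a +ᶻ c ≋ b +ᶻ d
  +-cong-≋ {a} {b} {c} {d} (mk≋ p) (mk≋ q) = mk≋ (subst (+ n ∣_) (interchange a b c d) (∣m∣n⇒∣m+n p q))
    where
    interchange : ∀ a b c d → (a -ᶻ b) +ᶻ (c -ᶻ d) ≡ (a +ᶻ c) -ᶻ (b +ᶻ d)
    interchange = solve-∀

  +-congˡ-≋ : ∀ a {b c} → b ≋ c → a +ᶻ b ≋ a +ᶻ c
  +-congˡ-≋ a = +-cong-≋ (≡⇒≋ {a} refl)

  +-congʳ-≋ : ∀ {a b} c → a ≋ b → a +ᶻ c ≋ b +ᶻ c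
  +-congʳ-≋ c p = +-cong-≋ p (≡⇒≋ {c} refl)

  neg-cong-≋ : ∀ {a b} → a ≋ b → - a ≋ - b
  neg-cong-≋ {a} {b} (mk≋ p) = mk≋ (subst (+ n ∣_) (neg-distrib a b) (∣m⇒∣-m p))
    where
    neg-distrib : ∀ a b → - (a -ᶻ b) ≡ (- a) -ᶻ (- b)
    neg-distrib = solve-∀

  +n≋ : ∀ a → a +ᶻ + n ≋ a
  +n≋ a = mk≋ (divides 1ℤ (cancel a (+ n)))
    where
    cancel : ∀ a m → (a +ᶻ m) -ᶻ a ≡ 1ℤ *ᶻ m
    cancel = solve-∀

  -ᶻ-cong-≋ : ∀ {a b c d} → a ≋ b → c ≋ d → a -ᶻ c ≋ b -ᶻ d
  -ᶻ-cong-≋ p q = +-cong-≋ p (neg-cong-≋ q)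

  reflectIf-cong : ∀ b {x y} → x ≋ y → reflectIf b x ≋ reflectIf b y
  reflectIf-cong false p = p
  reflectIf-cong true  p = neg-cong-≋ p

  ∣ᵤ⇒≋ : ∀ a b → + n ℤ∣ᵤ.∣ a -ᶻ b → a ≋ b
  ∣ᵤ⇒≋ a b p = mk≋ (∣ᵤ⇒∣ {+ n} {a -ᶻ b} p)

  ≋⇒∣ᵤ : ∀ {a b} → a ≋ b → + n ℤ∣ᵤ.∣ a -ᶻ b
  ≋⇒∣ᵤ (mk≋ p) = ∣⇒∣ᵤ p

  -ᶻ-≋0⇒≋ : ∀ {a b} → a -ᶻ b ≋ 0ℤ → a ≋ b
  -ᶻ-≋0⇒≋ {a} {b} (mk≋ p) = mk≋ (subst (+ n ∣_) (ℤₚ.+-identityʳ (a -ᶻ b)) p)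

  +-≋-injective-< : ∀ {a b} → a < n → b < n → + a ≋ + b → a ≡ b
  +-≋-injective-< {a} {b} a<n b<n p = Sum.[ (λ b≤a → injective-≥ a<n b≤a p)
                                          , (λ a≤b → sym (injective-≥ b<n a≤b (≋-sym p))) ]′ (ℕₚ.≤-total b a)
    where
    injective-≥ : ∀ {a b} → a < n → b ≤ a → + a ≋ + b → a ≡ b
    injective-≥ {a} {b} a<n b≤a p =
      ℕₚ.≤-antisym (ℕₚ.m∸n≡0⇒m≤n (∣∧<⇒≡0 n∣a∸b (ℕₚ.≤-<-trans (ℕₚ.m∸n≤m a b) a<n))) b≤a
      where
      n∣a∸b : n ℕ∣.∣ a ∸ b
      n∣a∸b = subst (λ z → n ℕ∣.∣ ℤ.∣ z ∣) (trans (ℤₚ.m-n≡m⊖n a b) (ℤₚ.⊖-≥ b≤a)) (≋⇒∣ᵤ p)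

  ⟦⟧-≋-injective : ∀ {x y : Fin n} → ⟦ x ⟧ ≋ ⟦ y ⟧ → x ≡ y
  ⟦⟧-≋-injective {x} {y} p = Finₚ.toℕ-injective (+-≋-injective-< (Finₚ.toℕ<n x) (Finₚ.toℕ<n y) p)

  %ℕ-≋ : ∀ z → + (z %ℕ n) ≋ z
  %ℕ-≋ z = ≋-sym (mk≋ (divides (z /ℕ n) (quotient-form z (+ (z %ℕ n)) (z /ℕ n) (a≡a%ℕn+[a/ℕn]*n z n))))
    where
    quotient-form : ∀ z r q → z ≡ r +ᶻ q *ᶻ + n → z -ᶻ r ≡ q *ᶻ + n
    quotient-form z r q refl = cancel r q (+ n)
      where
      cancel : ∀ r q m → (r +ᶻ q *ᶻ m) -ᶻ r ≡ q *ᶻ m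
      cancel = solve-∀

  vertex : ℤ → Fin n
  vertex z = fromℕ< (n%ℕd<d z n)

  ⟦vertex⟧ : ∀ z → ⟦ vertex z ⟧ ≋ z
  ⟦vertex⟧ z = subst (_≋ z) (cong +_ (sym (Finₚ.toℕ-fromℕ< (n%ℕd<d z n)))) (%ℕ-≋ z)

  vertex-⟦⟧ : ∀ x → vertex ⟦ x ⟧ ≡ x
  vertex-⟦⟧ x = ⟦⟧-≋-injective (⟦vertex⟧ ⟦ x ⟧)

  +-≋-self⇒≋0 : ∀ w z → w +ᶻ z ≋ z → w ≋ 0ℤ
  +-≋-self⇒≋0 w z p = begin
    w                   ≡⟨ cancel w z ⟩
    (w +ᶻ z) -ᶻ z       ≈⟨ +-congʳ-≋ (- z) p ⟩
    z -ᶻ z              ≡⟨ ℤₚ.+-inverseʳ z ⟩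
    0ℤ                  ∎
    where
    cancel : ∀ w z → w ≡ (w +ᶻ z) -ᶻ z
    cancel = solve-∀

  shift-≉ : ∀ b {c} z → 0 < c → c < n → ¬ (reflectIf b (+ c) +ᶻ z ≋ z)
  shift-≉ b {c} z 0<c c<n p =
    ℕₚ.<⇒≢ 0<c (sym (+-≋-injective-< c<n (ℕₚ.≤-<-trans z≤n c<n) (+c≋0 b (+-≋-self⇒≋0 _ z p))))
    where
    +c≋0 : ∀ b → reflectIf b (+ c) ≋ 0ℤ → + c ≋ 0ℤ
    +c≋0 false q = q
    +c≋0 true  q = ≋-trans (≡⇒≋ (sym (ℤₚ.neg-involutive (+ c)))) (neg-cong-≋ q)

module DihedralAction (n : ℕ) .{{_ : NonZero n}} where
  open Congruence n
  open import Relation.Binary.Reasoning.Setoid ≋-setoid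

  act-congʳ : ∀ p {x y} → x ≋ y → act p x ≋ act p y
  act-congʳ (b , a) p = +-congˡ-≋ a (reflectIf-cong b p)

  act-congˡ : ∀ {p q} → _≈Dih_ {n} p q → ∀ z → act p z ≋ act q z
  act-congˡ {b , a} {_ , a'} (refl , a∣a') z = +-congʳ-≋ (reflectIf b z) (∣ᵤ⇒≋ a a' a∣a')

  record _actsAs_ (f : Fin n → Fin n) (p : Bool × ℤ) : Set where
    constructor mkActsAs
    field on : ∀ x → ⟦ f x ⟧ ≋ act p ⟦ x ⟧
  open _actsAs_ public

  actsAs-vertex : ∀ {f p} → f actsAs p → ∀ z → ⟦ f (vertex z) ⟧ ≋ act p z
  actsAs-vertex {f} {p} fp z = ≋-trans (on fp (vertex z)) (act-congʳ p (⟦vertex⟧ z))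

  vertex∘act-actsAs : ∀ p → (λ x → vertex (act p ⟦ x ⟧)) actsAs p
  vertex∘act-actsAs p = mkActsAs λ x → ⟦vertex⟧ (act p ⟦ x ⟧)

  actsAs-id : (λ x → x) actsAs (false , 0ℤ)
  actsAs-id = mkActsAs λ x → ≡⇒≋ (sym (act-identity ⟦ x ⟧))

  actsAs-∘ : ∀ {f g p q} → f actsAs p → g actsAs q → (λ x → f (g x)) actsAs (p ∙Dih q)
  actsAs-∘ {f} {g} {p} {q} fp gq = mkActsAs λ x → begin
    ⟦ f (g x) ⟧              ≈⟨ on fp (g x) ⟩
    act p ⟦ g x ⟧            ≈⟨ act-congʳ p (on gq x) ⟩
    act p (act q ⟦ x ⟧)      ≡⟨ act-∙ p q ⟦ x ⟧ ⟨
    act (p ∙Dih q) ⟦ x ⟧     ∎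

  actsAs-inverse : ∀ {f g p} → (∀ y → f (g y) ≡ y) → f actsAs p → g actsAs invDih p
  actsAs-inverse {f} {g} {p} fg fp = mkActsAs λ y → begin
    ⟦ g y ⟧                          ≡⟨ act-cancel (invDih p) p ⟦ g y ⟧ (∙Dih-inverseˡ p) ⟨
    act (invDih p) (act p ⟦ g y ⟧)   ≈⟨ act-congʳ (invDih p) (on fp (g y)) ⟨
    act (invDih p) ⟦ f (g y) ⟧       ≡⟨ cong (λ x → act (invDih p) ⟦ x ⟧) (fg y) ⟩
    act (invDih p) ⟦ y ⟧             ∎

  actsAs-pointwise : ∀ {f g p} → (∀ x → f x ≡ g x) → f actsAs p → g actsAs p
  actsAs-pointwise {p = p} f≗g fp = mkActsAs λ x → subst (λ y → ⟦ y ⟧ ≋ act p ⟦ x ⟧) (f≗g x) (on fp x)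

  actsAs-≈Dih⇒≗ : ∀ {f g p q} → f actsAs p → g actsAs q → _≈Dih_ {n} p q → ∀ x → f x ≡ g x
  actsAs-≈Dih⇒≗ {f} {g} {p} {q} fp gq p≈q x = ⟦⟧-≋-injective (begin
    ⟦ f x ⟧          ≈⟨ on fp x ⟩
    act p ⟦ x ⟧      ≈⟨ act-congˡ {p} {q} p≈q ⟦ x ⟧ ⟩
    act q ⟦ x ⟧      ≈⟨ on gq x ⟨
    ⟦ g x ⟧          ∎)

  actsAs-cancel : ∀ {f g p q} → f actsAs p → g actsAs q → p ∙Dih q ≡ (false , 0ℤ) → ∀ x → f (g x) ≡ x
  actsAs-cancel {f} {g} {p} {q} fp gq pq≡ε x = ⟦⟧-≋-injective (begin
    ⟦ f (g x) ⟧             ≈⟨ on (actsAs-∘ fp gq) x ⟩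
    act (p ∙Dih q) ⟦ x ⟧    ≡⟨ cong (λ r → act r ⟦ x ⟧) pq≡ε ⟩
    act (false , 0ℤ) ⟦ x ⟧  ≡⟨ act-identity ⟦ x ⟧ ⟩
    ⟦ x ⟧                   ∎)

  actsAs-difference : ∀ {f p} → f actsAs p →
                      ∀ u v → ⟦ f u ⟧ -ᶻ ⟦ f v ⟧ ≋ reflectIf (proj₁ p) (⟦ u ⟧ -ᶻ ⟦ v ⟧)
  actsAs-difference {f} {p} fp u v = begin
    ⟦ f u ⟧ -ᶻ ⟦ f v ⟧             ≈⟨ -ᶻ-cong-≋ (on fp u) (on fp v) ⟩
    act p ⟦ u ⟧ -ᶻ act p ⟦ v ⟧     ≡⟨ act-difference p ⟦ u ⟧ ⟦ v ⟧ ⟩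
    reflectIf (proj₁ p) (⟦ u ⟧ -ᶻ ⟦ v ⟧) ∎

  CycleAdj : Fin n → Fin n → Set
  CycleAdj u v = Σ Bool λ b → ⟦ v ⟧ ≋ ⟦ u ⟧ +ᶻ reflectIf b 1ℤ

  cycleAdj-suc : ∀ i → CycleAdj (vertex (+ i)) (vertex (+ suc i))
  cycleAdj-suc i = false , (begin
    ⟦ vertex (+ suc i) ⟧       ≈⟨ ⟦vertex⟧ (+ suc i) ⟩
    1ℤ +ᶻ + i                  ≡⟨ ℤₚ.+-comm 1ℤ (+ i) ⟩
    + i +ᶻ 1ℤ                  ≈⟨ +-congʳ-≋ 1ℤ (⟦vertex⟧ (+ i)) ⟨
    ⟦ vertex (+ i) ⟧ +ᶻ 1ℤ     ∎)

  actsAs-cycleAdj : ∀ {f p u v} → f actsAs p → CycleAdj u v → CycleAdj (f u) (f v)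
  actsAs-cycleAdj {f} {p@(b , a)} {u} {v} fp (b' , q) = b xor b' , (begin
    ⟦ f v ⟧                                  ≈⟨ on fp v ⟩
    act p ⟦ v ⟧                              ≈⟨ act-congʳ p (≋-trans q (≡⇒≋ (ℤₚ.+-comm ⟦ u ⟧ (reflectIf b' 1ℤ)))) ⟩
    act p (reflectIf b' 1ℤ +ᶻ ⟦ u ⟧)         ≡⟨ act-+ p ⟦ u ⟧ (reflectIf b' 1ℤ) ⟨
    act p ⟦ u ⟧ +ᶻ reflectIf b (reflectIf b' 1ℤ) ≡⟨ cong (act p ⟦ u ⟧ +ᶻ_) (reflectIf-xor b b' 1ℤ) ⟩
    act p ⟦ u ⟧ +ᶻ reflectIf (b xor b') 1ℤ   ≈⟨ +-congʳ-≋ _ (on fp u) ⟨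
    ⟦ f u ⟧ +ᶻ reflectIf (b xor b') 1ℤ       ∎)

  module _ (2<n : 2 < n) where

    cycleAdj⇒≢ : ∀ {u v} → CycleAdj u v → u ≢ v
    cycleAdj⇒≢ {u} (b , p) refl =
      shift-≉ b ⟦ u ⟧ (s≤s z≤n) (ℕₚ.<-trans (s≤s (s≤s z≤n)) 2<n)
        (≋-sym (≋-trans p (≡⇒≋ (ℤₚ.+-comm ⟦ u ⟧ (reflectIf b 1ℤ)))))

    reflectIf-1-injective : ∀ b b' → reflectIf b 1ℤ ≋ reflectIf b' 1ℤ → b ≡ b'
    reflectIf-1-injective false false _ = refl
    reflectIf-1-injective true  true  _ = refl
    reflectIf-1-injective false true  p = ⊥-elim (shift-≉ false (- 1ℤ) (s≤s z≤n) 2<n p)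
    reflectIf-1-injective true  false p = ⊥-elim (shift-≉ false (- 1ℤ) (s≤s z≤n) 2<n (≋-sym p))

    actsAs-unique : ∀ {f p q} → f actsAs p → f actsAs q → _≈Dih_ {n} p q
    actsAs-unique {f} {p@(b , a)} {q@(b' , a')} fp fq =
      reflectIf-1-injective b b' unit-steps-agree , ≋⇒∣ᵤ (subst₂ _≋_ (act-zero p) (act-zero q) (agree 0ℤ))
      where
      agree : ∀ z → act p z ≋ act q z
      agree z = ≋-trans (≋-sym (actsAs-vertex fp z)) (actsAs-vertex fq z)

      unit-steps-agree : reflectIf b 1ℤ ≋ reflectIf b' 1ℤ
      unit-steps-agree = begin
        reflectIf b 1ℤ              ≡⟨ act-difference p 1ℤ 0ℤ ⟨
        act p 1ℤ -ᶻ act p 0ℤ        ≈⟨ -ᶻ-cong-≋ (agree 1ℤ) (agree 0ℤ) ⟩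
        act q 1ℤ -ᶻ act q 0ℤ        ≡⟨ act-difference q 1ℤ 0ℤ ⟩
        reflectIf b' 1ℤ             ∎

    module _ {f : Fin n → Fin n} (f-injective : ∀ {x y} → f x ≡ f y → x ≡ y)
             (f-cycleAdj : ∀ {u v} → CycleAdj u v → CycleAdj (f u) (f v)) where

      cycleAdj-rigid : ∀ b → ⟦ f (vertex 1ℤ) ⟧ ≋ ⟦ f (vertex 0ℤ) ⟧ +ᶻ reflectIf b 1ℤ →
                       f actsAs (b , ⟦ f (vertex 0ℤ) ⟧)
      cycleAdj-rigid b f₁ = mkActsAs λ x →
        ≋-trans (≡⇒≋ (cong (λ y → ⟦ f y ⟧) (sym (vertex-⟦⟧ x)))) (proj₁ (along (toℕ x)))
        where
        p : Bool × ℤ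
        p = (b , ⟦ f (vertex 0ℤ) ⟧)

        Along : ℕ → Set
        Along i = ⟦ f (vertex (+ i)) ⟧ ≋ act p (+ i)

        no-backtrack : ∀ i → ¬ (⟦ f (vertex (+ suc (suc i))) ⟧ ≋ ⟦ f (vertex (+ i)) ⟧)
        no-backtrack i q = shift-≉ false (+ i) (s≤s z≤n) 2<n (begin
          + suc (suc i)                    ≈⟨ ⟦vertex⟧ (+ suc (suc i)) ⟨
          ⟦ vertex (+ suc (suc i)) ⟧       ≡⟨ cong ⟦_⟧ (f-injective (⟦⟧-≋-injective q)) ⟩
          ⟦ vertex (+ i) ⟧                 ≈⟨ ⟦vertex⟧ (+ i) ⟩
          + i                              ∎)

        step : ∀ i → Along i → Along (suc i) → Along (suc (suc i))
        step i h₀ h₁ = continue (f-cycleAdj (cycleAdj-suc (suc i)))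
          where
          continue : CycleAdj (f (vertex (+ suc i))) (f (vertex (+ suc (suc i)))) → Along (suc (suc i))
          continue (b' , q) = Sum.[ forward , backward ] (reflectIf-1-dichotomy b b')
            where
            moved : ⟦ f (vertex (+ suc (suc i))) ⟧ ≋ act p (+ suc i) +ᶻ reflectIf b' 1ℤ
            moved = ≋-trans q (+-congʳ-≋ (reflectIf b' 1ℤ) h₁)

            forward : reflectIf b' 1ℤ ≡ reflectIf b 1ℤ → Along (suc (suc i))
            forward same = begin
              ⟦ f (vertex (+ suc (suc i))) ⟧        ≈⟨ moved ⟩
              act p (+ suc i) +ᶻ reflectIf b' 1ℤ    ≡⟨ cong (act p (+ suc i) +ᶻ_) same ⟩
              act p (+ suc i) +ᶻ reflectIf b 1ℤ     ≡⟨ act-+ p (+ suc i) 1ℤ ⟩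
              act p (+ suc (suc i))                 ∎

            backward : reflectIf b' 1ℤ ≡ reflectIf b (- 1ℤ) → Along (suc (suc i))
            backward opposite = ⊥-elim (no-backtrack i (begin
              ⟦ f (vertex (+ suc (suc i))) ⟧        ≈⟨ moved ⟩
              act p (+ suc i) +ᶻ reflectIf b' 1ℤ    ≡⟨ cong (act p (+ suc i) +ᶻ_) opposite ⟩
              act p (+ suc i) +ᶻ reflectIf b (- 1ℤ) ≡⟨ act-+ p (+ suc i) (- 1ℤ) ⟩
              act p (+ i)                           ≈⟨ h₀ ⟨
              ⟦ f (vertex (+ i)) ⟧                  ∎))

        along : ∀ i → Along i × Along (suc i)
        along zero    = ≡⇒≋ (sym (act-zero p)) , f₁
        along (suc i) = let (h₀ , h₁) = along i in h₁ , step i h₀ h₁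

module Circulant (n k : ℕ) .{{_ : NonZero n}} where
  open Congruence n
  open DihedralAction n
  open import Relation.Binary.Reasoning.Setoid ≋-setoid

  infix 4 _≋±_
  _≋±_ : ℤ → ℕ → Set
  z ≋± s = z ≋ + s ⊎ z ≋ - + s

  ≋±-cong : ∀ {z z' s} → z ≋ z' → z ≋± s → z' ≋± s
  ≋±-cong z≋z' = Sum.map (≋-trans (≋-sym z≋z')) (≋-trans (≋-sym z≋z'))

  ≋±-reflectIf : ∀ b {z s} → z ≋± s → reflectIf b z ≋± s
  ≋±-reflectIf false         p        = p
  ≋±-reflectIf true          (inj₁ p) = inj₂ (neg-cong-≋ p)
  ≋±-reflectIf true {s = s}  (inj₂ p) = inj₁ (≋-trans (neg-cong-≋ p) (≡⇒≋ (ℤₚ.neg-involutive (+ s))))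

  ≋±0⇒≋0 : ∀ {z} → z ≋± 0 → z ≋ 0ℤ
  ≋±0⇒≋0 (inj₁ p) = p
  ≋±0⇒≋0 (inj₂ p) = p

  Jump : ℤ → Set
  Jump z = ∃[ s ] (1 ≤ s × s ≤ k × z ≋± s)

  jump-cong : ∀ {z z'} → z ≋ z' → Jump z → Jump z'
  jump-cong z≋z' (s , 1≤s , s≤k , p) = s , 1≤s , s≤k , ≋±-cong z≋z' p

  jump-reflectIf : ∀ b {z} → Jump z → Jump (reflectIf b z)
  jump-reflectIf b (s , 1≤s , s≤k , p) = s , 1≤s , s≤k , ≋±-reflectIf b p

  circAdj⇒jump : ∀ {u v} → CircAdj n k u v → Jump (⟦ u ⟧ -ᶻ ⟦ v ⟧)
  circAdj⇒jump {u} {v} (s , 1≤s , s≤k , p) =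
    s , 1≤s , s≤k , Sum.map (∣ᵤ⇒≋ (⟦ u ⟧ -ᶻ ⟦ v ⟧) (+ s)) (∣ᵤ⇒≋ (⟦ u ⟧ -ᶻ ⟦ v ⟧) (- + s)) p

  jump⇒circAdj : ∀ {u v} → Jump (⟦ u ⟧ -ᶻ ⟦ v ⟧) → CircAdj n k u v
  jump⇒circAdj (s , 1≤s , s≤k , p) = s , 1≤s , s≤k , Sum.map ≋⇒∣ᵤ ≋⇒∣ᵤ p

  actsAs-circAdj : ∀ {f p} → f actsAs p → ∀ {u v} → CircAdj n k u v → CircAdj n k (f u) (f v)
  actsAs-circAdj {f} {p} fp {u} {v} adj =
    jump⇒circAdj {f u} {f v}
      (jump-cong (≋-sym (actsAs-difference fp u v)) (jump-reflectIf (proj₁ p) (circAdj⇒jump {u} {v} adj)))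

  affineAut : Bool × ℤ → CircAut n k
  affineAut p = record
    { fun     = fun′
    ; inv     = inv′
    ; inv-fun = inv′-fun′
    ; fun-inv = actsAs-cancel fun′-actsAs inv′-actsAs (∙Dih-inverseʳ p)
    ; adj→    = λ u v → actsAs-circAdj fun′-actsAs
    ; adj←    = λ u v adj → subst₂ (CircAdj n k) (inv′-fun′ u) (inv′-fun′ v)
                              (actsAs-circAdj inv′-actsAs adj)
    }
    where
    fun′ inv′ : Fin n → Fin n
    fun′ x = vertex (act p ⟦ x ⟧)
    inv′ y = vertex (act (invDih p) ⟦ y ⟧)
    fun′-actsAs : fun′ actsAs p
    fun′-actsAs = vertex∘act-actsAs p
    inv′-actsAs : inv′ actsAs invDih p
    inv′-actsAs = vertex∘act-actsAs (invDih p)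
    inv′-fun′ : ∀ x → inv′ (fun′ x) ≡ x
    inv′-fun′ = actsAs-cancel inv′-actsAs fun′-actsAs (∙Dih-inverseˡ p)

  Short : ℤ → Set
  Short z = ∃[ s ] (s ≤ k × z ≋± s)

  short-cong : ∀ {z z'} → z ≋ z' → Short z → Short z'
  short-cong z≋z' (s , s≤k , p) = s , s≤k , ≋±-cong z≋z' p

  short-reflectIf : ∀ b {z} → Short z → Short (reflectIf b z)
  short-reflectIf b (s , s≤k , p) = s , s≤k , ≋±-reflectIf b p

  short-of-bounds : ∀ {a b} → a ≤ b + k → b ≤ a + k → Short (+ a -ᶻ + b)
  short-of-bounds {a} {b} a≤b+k b≤a+k with ℕₚ.≤-total b a
  ... | inj₁ b≤a with ℕₚ.m≤n⇒∃[o]m+o≡n b≤a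
  ...   | c , refl = c , ℕₚ.+-cancelˡ-≤ b c k a≤b+k , inj₁ (begin
    + (b + c) -ᶻ + b       ≡⟨ cong (_-ᶻ + b) (ℤₚ.pos-+ b c) ⟩
    (+ b +ᶻ + c) -ᶻ + b    ≡⟨ cancel (+ b) (+ c) ⟩
    + c                    ∎)
    where
    cancel : ∀ b c → (b +ᶻ c) -ᶻ b ≡ c
    cancel = solve-∀
  short-of-bounds {a} {b} a≤b+k b≤a+k | inj₂ a≤b with ℕₚ.m≤n⇒∃[o]m+o≡n a≤b
  ...   | c , refl = c , ℕₚ.+-cancelˡ-≤ a c k b≤a+k , inj₂ (begin
    + a -ᶻ + (a + c)       ≡⟨ cong (λ w → + a -ᶻ w) (ℤₚ.pos-+ a c) ⟩
    + a -ᶻ (+ a +ᶻ + c)    ≡⟨ cancel (+ a) (+ c) ⟩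
    - + c                  ∎)
    where
    cancel : ∀ a c → a -ᶻ (a +ᶻ c) ≡ - c
    cancel = solve-∀

  ¬short-at : ∀ {t} → k < t → t + k < n → ¬ Short (+ t)
  ¬short-at {t} k<t t+k<n (s , s≤k , inj₁ p) =
    ℕₚ.<⇒≢ (ℕₚ.≤-<-trans s≤k k<t) (sym (+-≋-injective-< t<n s<n p))
    where
    t<n : t < n
    t<n = ℕₚ.≤-<-trans (ℕₚ.m≤m+n t k) t+k<n
    s<n : s < n
    s<n = ℕₚ.≤-<-trans s≤k (ℕₚ.<-trans k<t t<n)
  ¬short-at {t} k<t t+k<n (s , s≤k , inj₂ p) =
    ℕₚ.<⇒≢ (ℕₚ.≤-<-trans z≤n k<t)
      (sym (ℕₚ.m+n≡0⇒m≡0 t (+-≋-injective-< t+s<n (ℕₚ.≤-<-trans z≤n t+k<n) t+s≋0)))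
    where
    t+s<n : t + s < n
    t+s<n = ℕₚ.≤-<-trans (ℕₚ.+-monoʳ-≤ t s≤k) t+k<n
    t+s≋0 : + (t + s) ≋ 0ℤ
    t+s≋0 = begin
      + (t + s)          ≡⟨ ℤₚ.pos-+ t s ⟩
      + t +ᶻ + s         ≈⟨ +-congʳ-≋ (+ s) p ⟩
      - + s +ᶻ + s       ≡⟨ ℤₚ.+-inverseˡ (+ s) ⟩
      0ℤ                 ∎

  -- The congruence + a -ᶻ + b ≡ + t (mod n) is passed as an equation in ℕ, for the ℕ ring solver.
  ¬short-of : ∀ {a b t} → k < t → t + k < n → a + n ≡ t + b → ¬ Short (+ a -ᶻ + b)
  ¬short-of {a} {b} {t} k<t t+k<n a+n≡t+b = ¬short-at k<t t+k<n ∘ short-cong (begin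
    + a -ᶻ + b                 ≈⟨ +n≋ (+ a -ᶻ + b) ⟨
    (+ a -ᶻ + b) +ᶻ + n        ≡⟨ regroup (+ a) (+ b) (+ n) ⟩
    (+ a +ᶻ + n) -ᶻ + b        ≡⟨ cong (_-ᶻ + b) (lift a+n≡t+b) ⟩
    (+ t +ᶻ + b) -ᶻ + b        ≡⟨ cancel (+ t) (+ b) ⟩
    + t                        ∎)
    where
    lift : a + n ≡ t + b → + a +ᶻ + n ≡ + t +ᶻ + b
    lift eq = trans (sym (ℤₚ.pos-+ a n)) (trans (cong +_ eq) (ℤₚ.pos-+ t b))
    regroup : ∀ a b m → (a -ᶻ b) +ᶻ m ≡ (a +ᶻ m) -ᶻ b
    regroup = solve-∀
    cancel : ∀ t b → (t +ᶻ b) -ᶻ b ≡ t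
    cancel = solve-∀

  Ball : Fin n → Fin n → Set
  Ball u x = x ≡ u ⊎ CircAdj n k u x

  ball⇒short : ∀ {u x} → Ball u x → Short (⟦ x ⟧ -ᶻ ⟦ u ⟧)
  ball⇒short {u} (inj₁ refl) = 0 , z≤n , inj₁ (≡⇒≋ (ℤₚ.+-inverseʳ ⟦ u ⟧))
  ball⇒short {u} {x} (inj₂ adj) with circAdj⇒jump {u} {x} adj
  ... | s , _ , s≤k , p =
    short-cong (≡⇒≋ (neg-difference ⟦ u ⟧ ⟦ x ⟧)) (short-reflectIf true (s , s≤k , p))

  short⇒ball : ∀ {u x} → Short (⟦ x ⟧ -ᶻ ⟦ u ⟧) → Ball u x
  short⇒ball (zero , _ , p) = inj₁ (⟦⟧-≋-injective (-ᶻ-≋0⇒≋ (≋±0⇒≋0 p)))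
  short⇒ball {u} {x} (suc s , s≤k , p) = inj₂ (jump⇒circAdj {u} {x}
    (jump-cong (≡⇒≋ (neg-difference ⟦ x ⟧ ⟦ u ⟧)) (jump-reflectIf true (suc s , s≤s z≤n , s≤k , p))))

  Near : Fin n → Fin n → Set
  Near u v = ∀ {x y} → Ball u x → ¬ Ball v x → Ball u y → ¬ Ball v y → x ≡ y

  module _ (f : CircAut n k) where

    fun-injective : ∀ {x y} → fun f x ≡ fun f y → x ≡ y
    fun-injective {x} {y} fx≡fy = trans (sym (inv-fun f x)) (trans (cong (inv f) fx≡fy) (inv-fun f y))

    ball-preserved : ∀ {u x} → Ball u x → Ball (fun f u) (fun f x)
    ball-preserved (inj₁ refl) = inj₁ refl
    ball-preserved (inj₂ adj)  = inj₂ (adj→ f _ _ adj)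

    ball-reflected : ∀ {u x} → Ball (fun f u) (fun f x) → Ball u x
    ball-reflected (inj₁ fx≡fu) = inj₁ (fun-injective fx≡fu)
    ball-reflected (inj₂ adj)   = inj₂ (adj← f _ _ adj)

    near-preserved : ∀ {u v} → Near u v → Near (fun f u) (fun f v)
    near-preserved {u} {v} near {x} {y} bx ¬bx by ¬by =
      trans (sym (fun-inv f x)) (trans (cong (fun f) (near (pull bx) (¬bx ∘ push) (pull by) (¬by ∘ push))) (fun-inv f y))
      where
      pull : ∀ {x} → Ball (fun f u) x → Ball u (inv f x)
      pull {x} b = ball-reflected (subst (Ball (fun f u)) (sym (fun-inv f x)) b)
      push : ∀ {x} → Ball v (inv f x) → Ball (fun f v) x
      push {x} b = subst (Ball (fun f v)) (fun-inv f x) (ball-preserved b)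

  module _ (1≤k : 1 ≤ k) where

    short-edge : ∀ {z} → Short z → ¬ Short (z -ᶻ 1ℤ) → z ≋ - + k
    short-edge (zero , _ , p) ¬short =
      ⊥-elim (¬short (1 , 1≤k , inj₂ (+-congʳ-≋ (- 1ℤ) (≋±0⇒≋0 p))))
    short-edge (suc s , s<k , inj₁ p) ¬short =
      ⊥-elim (¬short (s , ℕₚ.<⇒≤ s<k , inj₁ (+-congʳ-≋ (- 1ℤ) p)))
    short-edge (s , s≤k , inj₂ p) ¬short with ℕₚ.m≤n⇒m<n∨m≡n s≤k
    ... | inj₂ refl = p
    ... | inj₁ s<k  = ⊥-elim (¬short (suc s , s<k , inj₂ (≋-trans (+-congʳ-≋ (- 1ℤ) p) (≡⇒≋ (step-down (+ s))))))
      where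
      step-down : ∀ w → - w -ᶻ 1ℤ ≡ - (1ℤ +ᶻ w)
      step-down = solve-∀

    near-0-1 : Near (vertex 0ℤ) (vertex 1ℤ)
    near-0-1 bx ¬bx by ¬by = ⟦⟧-≋-injective (≋-trans (outside bx ¬bx) (≋-sym (outside by ¬by)))
      where
      outside : ∀ {x} → Ball (vertex 0ℤ) x → ¬ Ball (vertex 1ℤ) x → ⟦ x ⟧ ≋ - + k
      outside {x} bx ¬bx = short-edge
        (short-cong (≋-trans (+-congˡ-≋ ⟦ x ⟧ (neg-cong-≋ (⟦vertex⟧ 0ℤ))) (≡⇒≋ (ℤₚ.+-identityʳ ⟦ x ⟧))) (ball⇒short bx))
        (¬bx ∘ short⇒ball ∘ short-cong (+-congˡ-≋ ⟦ x ⟧ (neg-cong-≋ (≋-sym (⟦vertex⟧ 1ℤ)))))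

    cycleAdj⇒near : ∀ {u v} → CycleAdj u v → Near u v
    cycleAdj⇒near {u} {v} (b , v≋u±1) =
      subst₂ Near (⟦⟧-≋-injective g0≋u) (⟦⟧-≋-injective g1≋v) (near-preserved g near-0-1)
      where
      p : Bool × ℤ
      p = (b , ⟦ u ⟧)
      g : CircAut n k
      g = affineAut p
      g0≋u : ⟦ fun g (vertex 0ℤ) ⟧ ≋ ⟦ u ⟧
      g0≋u = ≋-trans (actsAs-vertex (vertex∘act-actsAs p) 0ℤ) (≡⇒≋ (act-zero p))
      g1≋v : ⟦ fun g (vertex 1ℤ) ⟧ ≋ ⟦ v ⟧
      g1≋v = ≋-trans (actsAs-vertex (vertex∘act-actsAs p) 1ℤ) (≋-sym v≋u±1)

    module _ (2k+3≤n : 2 * k + 3 ≤ n) where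

      no-separated-pair : ∀ {v d} a b → ⟦ v ⟧ ≡ + d → Near (vertex 0ℤ) v →
                          Short (+ a -ᶻ + b) → Short (+ suc a -ᶻ + b) →
                          ¬ Short (+ a -ᶻ + (b + d)) → ¬ Short (+ suc a -ᶻ + (b + d)) → ⊥
      no-separated-pair {v} {d} a b ⟦v⟧≡d near in₀ in₁ out₀ out₁ =
        cycleAdj⇒≢ (2k+3≤n⇒2<n k 2k+3≤n) (false , x₁≋x₀+1)
          (near (inside in₀) (outside a out₀) (inside in₁) (outside (suc a) out₁))
        where
        inside : ∀ {c} → Short c → Ball (vertex 0ℤ) (vertex c)
        inside {c} = short⇒ball ∘ short-cong (begin
          c                                ≡⟨ ℤₚ.+-identityʳ c ⟨
          c -ᶻ 0ℤ                          ≈⟨ -ᶻ-cong-≋ (⟦vertex⟧ c) (⟦vertex⟧ 0ℤ) ⟨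
          ⟦ vertex c ⟧ -ᶻ ⟦ vertex 0ℤ ⟧    ∎)

        outside : ∀ a′ → ¬ Short (+ a′ -ᶻ + (b + d)) → ¬ Ball v (vertex (+ a′ -ᶻ + b))
        outside a′ out = out ∘ short-cong (begin
          ⟦ vertex (+ a′ -ᶻ + b) ⟧ -ᶻ ⟦ v ⟧    ≈⟨ +-congʳ-≋ (- ⟦ v ⟧) (⟦vertex⟧ (+ a′ -ᶻ + b)) ⟩
          (+ a′ -ᶻ + b) -ᶻ ⟦ v ⟧               ≡⟨ cong (λ w → (+ a′ -ᶻ + b) -ᶻ w) ⟦v⟧≡d ⟩
          (+ a′ -ᶻ + b) -ᶻ + d                 ≡⟨ regroup (+ a′) (+ b) (+ d) ⟩
          + a′ -ᶻ (+ b +ᶻ + d)                 ≡⟨ cong (λ w → + a′ -ᶻ w) (ℤₚ.pos-+ b d) ⟨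
          + a′ -ᶻ + (b + d)                    ∎)
          ∘ ball⇒short
          where
          regroup : ∀ a b d → (a -ᶻ b) -ᶻ d ≡ a -ᶻ (b +ᶻ d)
          regroup = solve-∀

        x₁≋x₀+1 : ⟦ vertex (+ suc a -ᶻ + b) ⟧ ≋ ⟦ vertex (+ a -ᶻ + b) ⟧ +ᶻ 1ℤ
        x₁≋x₀+1 = begin
          ⟦ vertex (+ suc a -ᶻ + b) ⟧        ≈⟨ ⟦vertex⟧ (+ suc a -ᶻ + b) ⟩
          (1ℤ +ᶻ + a) -ᶻ + b                 ≡⟨ regroup (+ a) (+ b) ⟩
          (+ a -ᶻ + b) +ᶻ 1ℤ                 ≈⟨ +-congʳ-≋ 1ℤ (⟦vertex⟧ (+ a -ᶻ + b)) ⟨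
          ⟦ vertex (+ a -ᶻ + b) ⟧ +ᶻ 1ℤ      ∎
          where
          regroup : ∀ a b → (1ℤ +ᶻ a) -ᶻ b ≡ (a -ᶻ b) +ᶻ 1ℤ
          regroup = solve-∀

      short-jump-not-near : ∀ {v} e r → 2 * k + 3 + r ≡ n → suc e ≤ k + k →
                            ⟦ v ⟧ ≡ + (2 + e) → ¬ Near (vertex 0ℤ) v
      short-jump-not-near e r n≡ e<2k ⟦v⟧≡ near = no-separated-pair e k ⟦v⟧≡ near
        (short-of-bounds (ℕₚ.≤-trans (ℕₚ.n≤1+n e) e<2k) (ℕₚ.m≤n+m k e))
        (short-of-bounds e<2k (ℕₚ.m≤n+m k (suc e)))
        (¬short-of (s≤s (ℕₚ.m≤m+n k r)) (≤-via 1 (trans (bound₀ k r) n≡))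
                   (trans (cong (λ m → e + m) (sym n≡)) (offset₀ k r e)))
        (¬short-of (s≤s (ℕₚ.m≤n⇒m≤1+n (ℕₚ.m≤m+n k r))) (≤-via 0 (trans (bound₁ k r) n≡))
                   (trans (cong (λ m → suc e + m) (sym n≡)) (offset₁ k r e)))
        where
        bound₀ : ∀ k r → suc (suc (k + r) + k) + 1 ≡ 2 * k + 3 + r
        bound₀ = ℕ-Solver.solve-∀
        bound₁ : ∀ k r → suc (suc (suc (k + r)) + k) + 0 ≡ 2 * k + 3 + r
        bound₁ = ℕ-Solver.solve-∀
        offset₀ : ∀ k r e → e + (2 * k + 3 + r) ≡ suc (k + r) + (k + (2 + e))
        offset₀ = ℕ-Solver.solve-∀
        offset₁ : ∀ k r e → suc e + (2 * k + 3 + r) ≡ suc (suc (k + r)) + (k + (2 + e))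
        offset₁ = ℕ-Solver.solve-∀

      long-jump-not-near : ∀ {v} e m → k + k ≤ e → 4 + e + m ≡ n →
                           ⟦ v ⟧ ≡ + (2 + e) → ¬ Near (vertex 0ℤ) v
      long-jump-not-near e m 2k≤e n≡ ⟦v⟧≡ near with ℕₚ.m≤n⇒∃[o]m+o≡n 2k≤e
      ... | g , refl = no-separated-pair k 1 ⟦v⟧≡ near
        (short-of-bounds (ℕₚ.n≤1+n k) (ℕₚ.≤-trans 1≤k (ℕₚ.m≤m+n k k)))
        (short-of-bounds ℕₚ.≤-refl (s≤s z≤n))
        (¬short-of (s≤s (ℕₚ.m≤m+n k m)) (≤-via (2 + g) (trans (bound₀ k m g) n≡))
                   (trans (cong (λ w → k + w) (sym n≡)) (offset₀ k m g)))
        (¬short-of (s≤s (ℕₚ.m≤n⇒m≤1+n (ℕₚ.m≤m+n k m))) (≤-via (1 + g) (trans (bound₁ k m g) n≡))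
                   (trans (cong (λ w → suc k + w) (sym n≡)) (offset₁ k m g)))
        where
        bound₀ : ∀ k m g → suc (suc (k + m) + k) + (2 + g) ≡ 4 + (k + k + g) + m
        bound₀ = ℕ-Solver.solve-∀
        bound₁ : ∀ k m g → suc (suc (suc (k + m)) + k) + (1 + g) ≡ 4 + (k + k + g) + m
        bound₁ = ℕ-Solver.solve-∀
        offset₀ : ∀ k m g → k + (4 + (k + k + g) + m) ≡ suc (k + m) + (1 + (2 + (k + k + g)))
        offset₀ = ℕ-Solver.solve-∀
        offset₁ : ∀ k m g → suc k + (4 + (k + k + g) + m) ≡ suc (suc (k + m)) + (1 + (2 + (k + k + g)))
        offset₁ = ℕ-Solver.solve-∀

      near-0⇒cycleAdj : ∀ {v} → Near (vertex 0ℤ) v → vertex 0ℤ ≢ v → CycleAdj (vertex 0ℤ) v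
      near-0⇒cycleAdj {v} near 0≢v = by-offset (toℕ v) refl (Finₚ.toℕ<n v)
        where
        by-offset : ∀ d → toℕ v ≡ d → d < n → CycleAdj (vertex 0ℤ) v
        by-offset zero toℕv≡0 _ = ⊥-elim (0≢v (⟦⟧-≋-injective (begin
          ⟦ vertex 0ℤ ⟧    ≈⟨ ⟦vertex⟧ 0ℤ ⟩
          0ℤ               ≡⟨ cong +_ toℕv≡0 ⟨
          ⟦ v ⟧            ∎)))
        by-offset (suc zero) toℕv≡1 _ = false , (begin
          ⟦ v ⟧                    ≡⟨ cong +_ toℕv≡1 ⟩
          0ℤ +ᶻ 1ℤ                 ≈⟨ +-congʳ-≋ 1ℤ (⟦vertex⟧ 0ℤ) ⟨
          ⟦ vertex 0ℤ ⟧ +ᶻ 1ℤ      ∎)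
        by-offset (suc (suc e)) toℕv≡2+e 2+e<n with ℕₚ.m≤n⇒m<n∨m≡n 2+e<n
        ... | inj₂ 3+e≡n = true , (begin
          ⟦ v ⟧                    ≡⟨ cong +_ toℕv≡2+e ⟩
          - 1ℤ +ᶻ + (3 + e)        ≡⟨ cong (λ w → - 1ℤ +ᶻ + w) 3+e≡n ⟩
          - 1ℤ +ᶻ + n              ≈⟨ +n≋ (- 1ℤ) ⟩
          0ℤ -ᶻ 1ℤ                 ≈⟨ +-congʳ-≋ (- 1ℤ) (⟦vertex⟧ 0ℤ) ⟨
          ⟦ vertex 0ℤ ⟧ -ᶻ 1ℤ      ∎)
        ... | inj₁ 3+e<n with e ℕₚ.<? k + k | ℕₚ.m≤n⇒∃[o]m+o≡n 2k+3≤n | ℕₚ.m≤n⇒∃[o]m+o≡n 3+e<n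
        ...   | yes e<2k | r , n≡ | _      = ⊥-elim (short-jump-not-near e r n≡ e<2k (cong +_ toℕv≡2+e) near)
        ...   | no e≮2k  | _      | m , n≡ = ⊥-elim (long-jump-not-near e m (ℕₚ.≮⇒≥ e≮2k) n≡ (cong +_ toℕv≡2+e) near)

      near⇒cycleAdj : ∀ {u v} → Near u v → u ≢ v → CycleAdj u v
      near⇒cycleAdj {u} {v} near u≢v = subst₂ CycleAdj (inv-fun t u) (inv-fun t v) pulled-back
        where
        p : Bool × ℤ
        p = (false , - ⟦ u ⟧)

        t : CircAut n k
        t = affineAut p

        tu≡0 : fun t u ≡ vertex 0ℤ
        tu≡0 = ⟦⟧-≋-injective (begin
          ⟦ fun t u ⟧       ≈⟨ on (vertex∘act-actsAs p) u ⟩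
          - ⟦ u ⟧ +ᶻ ⟦ u ⟧  ≡⟨ ℤₚ.+-inverseˡ ⟦ u ⟧ ⟩
          0ℤ                ≈⟨ ⟦vertex⟧ 0ℤ ⟨
          ⟦ vertex 0ℤ ⟧     ∎)

        translated : CycleAdj (fun t u) (fun t v)
        translated = subst (λ w → CycleAdj w (fun t v)) (sym tu≡0)
          (near-0⇒cycleAdj (subst (λ w → Near w (fun t v)) tu≡0 (near-preserved t near))
                           (λ 0≡tv → u≢v (fun-injective t (trans tu≡0 0≡tv))))

        pulled-back : CycleAdj (inv t (fun t u)) (inv t (fun t v))
        pulled-back = actsAs-cycleAdj (vertex∘act-actsAs (invDih p)) translated

      cycleAdj-preserved : ∀ (f : CircAut n k) {u v} → CycleAdj u v → CycleAdj (fun f u) (fun f v)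
      cycleAdj-preserved f c =
        near⇒cycleAdj (near-preserved f (cycleAdj⇒near c)) (cycleAdj⇒≢ (2k+3≤n⇒2<n k 2k+3≤n) c ∘ fun-injective f)

module Isomorphism (k n : ℕ) (1≤k : 1 ≤ k) (2k+3≤n : 2 * k + 3 ≤ n) where

  2<n : 2 < n
  2<n = 2k+3≤n⇒2<n k 2k+3≤n

  instance
    n-nonZero : NonZero n
    n-nonZero = ℕ.>-nonZero (ℕₚ.<-trans (s≤s z≤n) 2<n)

  open Congruence n
  open DihedralAction n
  open Circulant n k
  open GroupMorphisms (AutGroup n k) (DihGroup n)

  -- Opaque, so that conversion checking never normalises this proof to compute the Bool in toDih.
  opaque
    unit-step : (f : CircAut n k) → CycleAdj (fun f (vertex 0ℤ)) (fun f (vertex 1ℤ))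
    unit-step f = cycleAdj-preserved 1≤k 2k+3≤n f (cycleAdj-suc 0)

  toDih : CircAut n k → Bool × ℤ
  toDih f = proj₁ (unit-step f) , ⟦ fun f (vertex 0ℤ) ⟧

  toDih-actsAs : ∀ f → fun f actsAs toDih f
  toDih-actsAs f = cycleAdj-rigid 2<n (fun-injective f) (cycleAdj-preserved 1≤k 2k+3≤n f)
                                 (proj₁ (unit-step f)) (proj₂ (unit-step f))

  toDih-unique : ∀ {f p} → fun f actsAs p → toDih f ≈Dih p
  toDih-unique {f} {p} fp = actsAs-unique 2<n (toDih-actsAs f) fp

  toDih-isGroupIsomorphism : IsGroupIsomorphism toDih
  toDih-isGroupIsomorphism = record
    { isGroupMonomorphism = record
      { isGroupHomomorphism = record
        { isMonoidHomomorphism = record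
          { isMagmaHomomorphism = record
            { isRelHomomorphism = record
              { cong = λ {f} {g} f≈g → toDih-unique {f} (actsAs-pointwise (λ x → sym (f≈g x)) (toDih-actsAs g)) }
            ; homo = λ f g → toDih-unique {f ∘Aut g} (actsAs-∘ (toDih-actsAs f) (toDih-actsAs g)) }
          ; ε-homo = toDih-unique {idAut} actsAs-id }
        ; ⁻¹-homo = λ f → toDih-unique {invAut f} (actsAs-inverse (fun-inv f) (toDih-actsAs f)) }
      ; injective = λ {f} {g} → actsAs-≈Dih⇒≗ (toDih-actsAs f) (toDih-actsAs g) }
    ; surjective = λ p → affineAut p , λ {g} g≈ →
        toDih-unique {g} (actsAs-pointwise (λ x → sym (g≈ x)) (vertex∘act-actsAs p))
    }

lemma34 : (k n : ℕ) → 1 ≤ k → 2 * k + 3 ≤ n → AutGroup n k ≅ DihGroup n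
lemma34 k n 1≤k 2k+3≤n = toDih , toDih-isGroupIsomorphism
  where open Isomorphism k n 1≤k 2k+3≤n
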